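{- Fix an integer $k\ge2$. Let $u$ and $v$ be factors of the same episturmian word $\omega$. Then $u\sim_k v$ if and only if $u\sim_{k-1}v$ and $u,v$ share a common prefix and a common suffix of length $\min\{|u|,k-1\}$. Consequently, $u\sim_k v$ if and only if $u$ and $v$ are Abelian equivalent and share a common prefix and a common suffix of length $\min\{|u|,k-1\}$.
   Context: $|u|_x$ is the number of occurrences of the non-empty word $x$ as a factor of $u$; $u\sim_k v$ means $|u|_x=|v|_x$ for all non-empty $x$ with $|x|\le k$; Abelian equivalence is $\sim_1$. An infinite word $\omega$ is episturmian if its set of factors is closed under reversal and, for each $n$, $\omega$ has at most one right special factor of length $n$ (a factor $y$ is right special if $yc$ and $yd$ are factors for two distinct letters $c,d$). -}

module Defs where

open import Data.Nat using (ℕ; zero; suc; _+_; _≤_; _⊔_; _⊓_)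
open import Data.Fin using (Fin; toℕ)
open import Data.Fin.Properties using (_≟_)
open import Data.List using (List; []; _∷_; length; reverse; take; tabulate)
open import Data.Product using (∃; _×_)
open import Relation.Binary.PropositionalEquality using (_≡_; _≢_)
open import Relation.Nullary using (yes; no)

Word : ℕ → Set
Word m = List (Fin m)

InfWord : ℕ → Set
InfWord m = ℕ → Fin m

isPrefix : ∀ {m} → Word m → Word m → ℕ
isPrefix [] _ = 1
isPrefix (_ ∷ _) [] = 0
isPrefix (a ∷ x) (b ∷ w) with a ≟ b
... | yes _ = isPrefix x w
... | no _ = 0

-- |u|_x : number of occurrences of x as a factor of u (x non-empty in use)
occ : ∀ {m} → Word m → Word m → ℕ
occ x [] = 0
occ x (c ∷ u) = isPrefix x (c ∷ u) + occ x u

_∼⟨_⟩_ : ∀ {m} → Word m → ℕ → Word m → Set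
u ∼⟨ k ⟩ v = ∀ x → x ≢ [] → length x ≤ k → occ x u ≡ occ x v

slice : ∀ {m} → InfWord m → ℕ → ℕ → Word m
slice ω i n = tabulate {n = n} (λ j → ω (i + toℕ j))

Factor : ∀ {m} → InfWord m → Word m → Set
Factor ω w = ∃ λ i → slice ω i (length w) ≡ w

RightSpecial : ∀ {m} → InfWord m → Word m → Set
RightSpecial ω y = ∃ λ c → ∃ λ d → c ≢ d × Factor ω (y Data.List.++ (c ∷ [])) × Factor ω (y Data.List.++ (d ∷ []))

Episturmian : ∀ {m} → InfWord m → Set
Episturmian ω =
  (∀ w → Factor ω w → Factor ω (reverse w)) ×
  (∀ y z → length y ≡ length z → RightSpecial ω y → RightSpecial ω z → y ≡ z)

pre : ∀ {m} → ℕ → Word m → Word m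
pre n u = take n u

suf : ∀ {m} → ℕ → Word m → Word m
suf n u = reverse (take n (reverse u))

-- Every occurrence of a word x in u either extends by one letter to the left
-- inside u or is a prefix of u; likewise on the right, with suffixes.  So, once
-- u ∼_j v, the agreement of the prefixes and suffixes of length ≤ j says exactly
-- that the left and the right one-letter extensions of every word of length j
-- have the same total number of occurrences in u and in v.  This gives (⇒).
-- For (⇐) we raise j one step at a time.  If w c is not left special in ω,
-- at most one left extension e w c occurs in u or v, so a w c occurs equally
-- often in both.  Closure under reversal makes left special
-- factors the reversals of right special ones, so there is at most one of
-- each length; hence at most one right extension a w d of a w can be
-- unbalanced, and since the right extensions are balanced in total, none is.
module Submission where

open import Defs
open import Data.Fin using (Fin; punchIn)
open import Data.Fin.Properties using (_≟_; all?; ¬∀⟶∃¬; punchInᵢ≢i)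
open import Data.List using ([]; _∷_; length; reverse; take; _∷ʳ_; [_]; initLast; _∷ʳ′_)
open import Data.List.Properties
  using (≡-dec; ∷-injective; ∷-injectiveʳ; ∷ʳ-injectiveʳ; length-++; length-take; length-reverse;
         unfold-reverse; reverse-involutive; reverse-injective; tabulate-cong)
open import Data.Nat using (ℕ; zero; suc; _+_; _≤_; _<_; _∸_; _⊓_; s≤s; z≤n; _≤?_)
open import Data.Nat.Properties
  using (+-0-commutativeMonoid; +-commutativeSemigroup; +-comm; +-identityʳ; +-suc;
         +-cancelˡ-≡; +-cancelʳ-≡; suc-injective; ≤-refl; ≤-trans; ≤-reflexive; ≤-antisym;
         ≰⇒>; n≤1+n; m≤n⇒m≤1+n; m≤n⇒m⊓n≡m; m⊓n≤m; m⊓n≤n; ⊓-glb)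
  renaming (_≟_ to _≟ℕ_)
open import Algebra.Properties.CommutativeMonoid.Sum +-0-commutativeMonoid
  using (sum; sum-cong-≗; sum-remove; sum-replicate-zero; ∑-distrib-+)
open import Algebra.Properties.CommutativeSemigroup +-commutativeSemigroup
  using (interchange; x∙yz≈zy∙x)
open import Data.Product using (_×_; _,_; proj₁; proj₂; ∃)
open import Data.Sum using (_⊎_; inj₁; inj₂)
open import Function.Base using (_∘_)
open import Function.Bundles using (_⇔_; mk⇔)
open import Relation.Nullary using (yes; no; ¬_; Dec; contradiction)
open import Relation.Nullary.Decidable using (¬?; _→-dec_; _×-dec_)
open import Relation.Binary.PropositionalEquality
  using (_≡_; _≢_; refl; sym; trans; cong; cong₂; subst; module ≡-Reasoning)

open ≡-Reasoning

sum-single : ∀ {m} (f : Fin m → ℕ) c → (∀ d → d ≢ c → f d ≡ 0) → sum f ≡ f c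
sum-single {suc m} f c f≡0 = begin
  sum f                     ≡⟨ sum-remove f ⟩
  f c + sum (f ∘ punchIn c) ≡⟨ cong (f c +_) (sum-cong-≗ λ i → f≡0 (punchIn c i) (punchInᵢ≢i c i)) ⟩
  f c + sum {m} (λ _ → 0)   ≡⟨ cong (f c +_) (sum-replicate-zero m) ⟩
  f c + 0                   ≡⟨ +-identityʳ (f c) ⟩
  f c                       ∎

sum-≡-at : ∀ {m} (f g : Fin m → ℕ) c → sum f ≡ sum g → (∀ d → d ≢ c → f d ≡ g d) → f c ≡ g c
sum-≡-at {suc m} f g c Σf≡Σg f≡g = +-cancelʳ-≡ (sum (f ∘ punchIn c)) (f c) (g c) (begin
  f c + sum (f ∘ punchIn c) ≡⟨ sum-remove f ⟨
  sum f                     ≡⟨ Σf≡Σg ⟩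
  sum g                     ≡⟨ sum-remove g ⟩
  g c + sum (g ∘ punchIn c) ≡⟨ cong (g c +_) (sum-cong-≗ λ i → sym (f≡g (punchIn c i) (punchInᵢ≢i c i))) ⟩
  g c + sum (f ∘ punchIn c) ∎)

sum-≡⇒≗ : ∀ {m} (f g : Fin m → ℕ) → sum f ≡ sum g →
  (∀ c d → c ≢ d → f c ≡ g c ⊎ f d ≡ g d) → ∀ c → f c ≡ g c
sum-≡⇒≗ f g Σf≡Σg one c with f c ≟ℕ g c
... | yes fc≡gc = fc≡gc
... | no fc≢gc = sum-≡-at f g c Σf≡Σg λ d d≢c → agree d (one d c d≢c)
  where
  agree : ∀ d → f d ≡ g d ⊎ f c ≡ g c → f d ≡ g d
  agree d (inj₁ fd≡gd) = fd≡gd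
  agree d (inj₂ fc≡gc) = contradiction fc≡gc fc≢gc

isEqual : ∀ {m} → Word m → Word m → ℕ
isEqual [] [] = 1
isEqual [] (_ ∷ _) = 0
isEqual (_ ∷ _) [] = 0
isEqual (a ∷ x) (b ∷ y) with a ≟ b
... | yes _ = isEqual x y
... | no _ = 0

isEqual-refl : ∀ {m} (x : Word m) → isEqual x x ≡ 1
isEqual-refl [] = refl
isEqual-refl (a ∷ x) with a ≟ a
... | yes _ = isEqual-refl x
... | no a≢a = contradiction refl a≢a

isEqual-≢ : ∀ {m} {x y : Word m} → x ≢ y → isEqual x y ≡ 0
isEqual-≢ {x = []} {[]} x≢y = contradiction refl x≢y
isEqual-≢ {x = []} {_ ∷ _} _ = refl
isEqual-≢ {x = _ ∷ _} {[]} _ = refl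
isEqual-≢ {x = a ∷ x} {b ∷ y} x≢y with a ≟ b
... | yes refl = isEqual-≢ (x≢y ∘ cong (a ∷_))
... | no _ = refl

isEqual-reverse : ∀ {m} (x y : Word m) → isEqual x y ≡ isEqual (reverse x) (reverse y)
isEqual-reverse x y with ≡-dec _≟_ x y
... | yes refl = trans (isEqual-refl x) (sym (isEqual-refl (reverse x)))
... | no x≢y = trans (isEqual-≢ x≢y) (sym (isEqual-≢ (x≢y ∘ reverse-injective)))

-- Counts the non-empty suffixes of u equal to w, so that isSuffix [] u ≡ 0.
isSuffix : ∀ {m} → Word m → Word m → ℕ
isSuffix w [] = 0
isSuffix w (c ∷ u) = isEqual w (c ∷ u) + isSuffix w u

isSuffix-[] : ∀ {m} (u : Word m) → isSuffix [] u ≡ 0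
isSuffix-[] [] = refl
isSuffix-[] (c ∷ u) = isSuffix-[] u

occ-[] : ∀ {m} (u : Word m) → occ [] u ≡ length u
occ-[] [] = refl
occ-[] (c ∷ u) = cong suc (occ-[] u)

isPrefix-∷-∷ : ∀ {m} (c : Fin m) (w u : Word m) → isPrefix (c ∷ w) (c ∷ u) ≡ isPrefix w u
isPrefix-∷-∷ c w u with c ≟ c
... | yes _ = refl
... | no c≢c = contradiction refl c≢c

sum-isPrefix-∷ : ∀ {m} (w u : Word m) c → sum (λ d → isPrefix (d ∷ w) (c ∷ u)) ≡ isPrefix w u
sum-isPrefix-∷ w u c = trans (sum-single _ c mismatch) (isPrefix-∷-∷ c w u)
  where
  mismatch : ∀ d → d ≢ c → isPrefix (d ∷ w) (c ∷ u) ≡ 0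
  mismatch d d≢c with d ≟ c
  ... | yes d≡c = contradiction d≡c d≢c
  ... | no _ = refl

sum-isPrefix-∷ʳ : ∀ {m} (w s : Word m) → isPrefix w s ≡ sum (λ d → isPrefix (w ∷ʳ d) s) + isEqual w s
sum-isPrefix-∷ʳ {m} [] [] = cong (_+ 1) (sym (sum-replicate-zero m))
sum-isPrefix-∷ʳ [] (c ∷ s) = sym (trans (+-identityʳ _) (sum-isPrefix-∷ [] s c))
sum-isPrefix-∷ʳ {m} (a ∷ w) [] = cong (_+ 0) (sym (sum-replicate-zero m))
sum-isPrefix-∷ʳ {m} (a ∷ w) (c ∷ s) with a ≟ c
... | yes _ = sum-isPrefix-∷ʳ w s
... | no _ = cong (_+ 0) (sym (sum-replicate-zero m))

isPrefix-∷ʳ : ∀ {m} (w s : Word m) c → isPrefix w (s ∷ʳ c) ≡ isPrefix w s + isEqual w (s ∷ʳ c)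
isPrefix-∷ʳ [] [] c = refl
isPrefix-∷ʳ [] (b ∷ s) c = refl
isPrefix-∷ʳ (a ∷ []) [] c with a ≟ c
... | yes _ = refl
... | no _ = refl
isPrefix-∷ʳ (a ∷ _ ∷ _) [] c with a ≟ c
... | yes _ = refl
... | no _ = refl
isPrefix-∷ʳ (a ∷ w) (b ∷ s) c with a ≟ b
... | yes _ = isPrefix-∷ʳ w s c
... | no _ = refl

isPrefix-∷ʳ-[] : ∀ {m} (w : Word m) c → isPrefix (w ∷ʳ c) [] ≡ 0
isPrefix-∷ʳ-[] [] c = refl
isPrefix-∷ʳ-[] (_ ∷ _) c = refl

isSuffix-reverse : ∀ {m} {w : Word m} u → w ≢ [] → isSuffix w u ≡ isPrefix (reverse w) (reverse u)
isSuffix-reverse {w = []} u w≢[] = contradiction refl w≢[]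
isSuffix-reverse {w = a ∷ w} [] _ =
  sym (trans (cong (λ t → isPrefix t []) (unfold-reverse a w)) (isPrefix-∷ʳ-[] (reverse w) a))
isSuffix-reverse {w = w} (c ∷ u) w≢[] = begin
  isEqual w (c ∷ u) + isSuffix w u
    ≡⟨ cong₂ _+_ (isEqual-reverse w (c ∷ u)) (isSuffix-reverse u w≢[]) ⟩
  isEqual rw (reverse (c ∷ u)) + isPrefix rw (reverse u)
    ≡⟨ +-comm (isEqual rw (reverse (c ∷ u))) _ ⟩
  isPrefix rw (reverse u) + isEqual rw (reverse (c ∷ u))
    ≡⟨ cong (λ t → isPrefix rw (reverse u) + isEqual rw t) (unfold-reverse c u) ⟩
  isPrefix rw (reverse u) + isEqual rw (reverse u ∷ʳ c)
    ≡⟨ isPrefix-∷ʳ rw (reverse u) c ⟨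
  isPrefix rw (reverse u ∷ʳ c)
    ≡⟨ cong (isPrefix rw) (unfold-reverse c u) ⟨
  isPrefix rw (reverse (c ∷ u)) ∎
  where
  rw = reverse w

occ-left-extensions : ∀ {m} a (w u : Word m) →
  occ (a ∷ w) u ≡ sum (λ d → occ (d ∷ a ∷ w) u) + isPrefix (a ∷ w) u
occ-left-extensions {m} a w [] = cong (_+ 0) (sym (sum-replicate-zero m))
occ-left-extensions a w (c ∷ u) = begin
  here + occ (a ∷ w) u      ≡⟨ cong (here +_) (occ-left-extensions a w u) ⟩
  here + (later + p)        ≡⟨ x∙yz≈zy∙x here later p ⟩
  (p + later) + here        ≡⟨ cong (λ t → (t + later) + here) (sum-isPrefix-∷ (a ∷ w) u c) ⟨
  (now + later) + here      ≡⟨ cong (_+ here) (∑-distrib-+ (λ d → isPrefix (d ∷ a ∷ w) (c ∷ u)) _) ⟨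
  sum (λ d → occ (d ∷ a ∷ w) (c ∷ u)) + here ∎
  where
  here = isPrefix (a ∷ w) (c ∷ u)
  p = isPrefix (a ∷ w) u
  now = sum (λ d → isPrefix (d ∷ a ∷ w) (c ∷ u))
  later = sum (λ d → occ (d ∷ a ∷ w) u)

occ-right-extensions : ∀ {m} (w u : Word m) →
  occ w u ≡ sum (λ d → occ (w ∷ʳ d) u) + isSuffix w u
occ-right-extensions {m} w [] = cong (_+ 0) (sym (sum-replicate-zero m))
occ-right-extensions w (c ∷ u) = begin
  isPrefix w (c ∷ u) + occ w u  ≡⟨ cong₂ _+_ (sum-isPrefix-∷ʳ w (c ∷ u)) (occ-right-extensions w u) ⟩
  (now + e) + (later + s)       ≡⟨ interchange now e later s ⟩
  (now + later) + (e + s)       ≡⟨ cong (_+ (e + s)) (∑-distrib-+ (λ d → isPrefix (w ∷ʳ d) (c ∷ u)) _) ⟨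
  sum (λ d → occ (w ∷ʳ d) (c ∷ u)) + isSuffix w (c ∷ u) ∎
  where
  now = sum (λ d → isPrefix (w ∷ʳ d) (c ∷ u))
  later = sum (λ d → occ (w ∷ʳ d) u)
  e = isEqual w (c ∷ u)
  s = isSuffix w u

length-sum-occ : ∀ {m} (u : Word m) → length u ≡ sum (λ d → occ [ d ] u)
length-sum-occ u = begin
  length u                                       ≡⟨ occ-[] u ⟨
  occ [] u                                       ≡⟨ occ-right-extensions [] u ⟩
  sum (λ d → occ [ d ] u) + isSuffix [] u        ≡⟨ cong (sum (λ d → occ [ d ] u) +_) (isSuffix-[] u) ⟩
  sum (λ d → occ [ d ] u) + 0                    ≡⟨ +-identityʳ _ ⟩
  sum (λ d → occ [ d ] u)                        ∎

isPrefix-take : ∀ {m} (z u : Word m) n → length z ≤ n → isPrefix z u ≡ isPrefix z (take n u)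
isPrefix-take [] u n _ = refl
isPrefix-take (a ∷ z) [] (suc n) _ = refl
isPrefix-take (a ∷ z) (b ∷ u) (suc n) (s≤s |z|≤n) with a ≟ b
... | yes _ = isPrefix-take z u n |z|≤n
... | no _ = refl

isPrefix-long : ∀ {m} (z u : Word m) → length u < length z → isPrefix z u ≡ 0
isPrefix-long (a ∷ z) [] _ = refl
isPrefix-long (a ∷ z) (b ∷ u) (s≤s |u|<|z|) with a ≟ b
... | yes _ = isPrefix-long z u |u|<|z|
... | no _ = refl

isPrefix-take-self : ∀ {m} n (u : Word m) → isPrefix (take n u) u ≡ 1
isPrefix-take-self zero u = refl
isPrefix-take-self (suc n) [] = refl
isPrefix-take-self (suc n) (b ∷ u) = trans (isPrefix-∷-∷ b (take n u) u) (isPrefix-take-self n u)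

isPrefix≢0⇒take : ∀ {m} (z v : Word m) → isPrefix z v ≢ 0 → take (length z) v ≡ z
isPrefix≢0⇒take [] v _ = refl
isPrefix≢0⇒take (a ∷ z) [] z≺v = contradiction refl z≺v
isPrefix≢0⇒take (a ∷ z) (b ∷ v) z≺v with a ≟ b
... | yes refl = cong (a ∷_) (isPrefix≢0⇒take z v z≺v)
... | no _ = contradiction refl z≺v

SamePrefixes : ∀ {m} → ℕ → Word m → Word m → Set
SamePrefixes K u v = ∀ z → length z ≤ K → isPrefix z u ≡ isPrefix z v

SamePrefixes⇒take-≡ : ∀ {m} {K n} {u v : Word m} → n ≤ length u → n ≤ K →
  SamePrefixes K u v → take n u ≡ take n v
SamePrefixes⇒take-≡ {n = n} {u} {v} n≤|u| n≤K same = begin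
  take n u       ≡⟨ isPrefix≢0⇒take w v w≺v ⟨
  take |w| v     ≡⟨ cong (λ k → take k v) |w|≡n ⟩
  take n v       ∎
  where
  w = take n u
  |w| = length w
  |w|≡n : |w| ≡ n
  |w|≡n = trans (length-take n u) (m≤n⇒m⊓n≡m n≤|u|)
  w≺v : isPrefix w v ≢ 0
  w≺v w⊀v with () ← trans (sym (isPrefix-take-self n u))
                      (trans (same w (subst (_≤ _) (sym |w|≡n) n≤K)) w⊀v)

take-≡⇒SamePrefixes : ∀ {m} {K} {u v : Word m} → length u ≡ length v →
  take (length u ⊓ K) u ≡ take (length u ⊓ K) v → SamePrefixes K u v
take-≡⇒SamePrefixes {K = K} {u} {v} |u|≡|v| pre≡ z |z|≤K with length z ≤? length u
... | yes |z|≤|u| = begin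
  isPrefix z u                      ≡⟨ isPrefix-take z u L |z|≤L ⟩
  isPrefix z (take L u)             ≡⟨ cong (isPrefix z) pre≡ ⟩
  isPrefix z (take L v)             ≡⟨ isPrefix-take z v L |z|≤L ⟨
  isPrefix z v                      ∎
  where
  L = length u ⊓ K
  |z|≤L = ⊓-glb |z|≤|u| |z|≤K
... | no |z|≰|u| = trans (isPrefix-long z u |u|<|z|) (sym (isPrefix-long z v (subst (_< _) |u|≡|v| |u|<|z|)))
  where
  |u|<|z| = ≰⇒> |z|≰|u|

∼-weaken : ∀ {m} {j k} {u v : Word m} → j ≤ k → u ∼⟨ k ⟩ v → u ∼⟨ j ⟩ v
∼-weaken j≤k u∼v x x≢[] |x|≤j = u∼v x x≢[] (≤-trans |x|≤j j≤k)

∼₁⇒length-≡ : ∀ {m} {u v : Word m} → u ∼⟨ 1 ⟩ v → length u ≡ length v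
∼₁⇒length-≡ {u = u} {v} u∼v = begin
  length u                  ≡⟨ length-sum-occ u ⟩
  sum (λ d → occ [ d ] u)   ≡⟨ sum-cong-≗ (λ d → u∼v [ d ] (λ ()) ≤-refl) ⟩
  sum (λ d → occ [ d ] v)   ≡⟨ length-sum-occ v ⟨
  length v                  ∎

length-∷ʳ : ∀ {m} (w : Word m) c → length (w ∷ʳ c) ≡ suc (length w)
length-∷ʳ w c = trans (length-++ w) (+-comm (length w) 1)

∼-suc⇒SamePrefixes : ∀ {m} {K} {u v : Word m} → u ∼⟨ suc K ⟩ v → SamePrefixes K u v
∼-suc⇒SamePrefixes u∼v [] _ = refl
∼-suc⇒SamePrefixes {u = u} {v} u∼v (a ∷ w) |aw|≤K = +-cancelˡ-≡ extended _ _ (begin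
  extended + isPrefix (a ∷ w) u                         ≡⟨ occ-left-extensions a w u ⟨
  occ (a ∷ w) u                                         ≡⟨ u∼v (a ∷ w) (λ ()) (m≤n⇒m≤1+n |aw|≤K) ⟩
  occ (a ∷ w) v                                         ≡⟨ occ-left-extensions a w v ⟩
  sum (λ d → occ (d ∷ a ∷ w) v) + isPrefix (a ∷ w) v    ≡⟨ cong (_+ isPrefix (a ∷ w) v) (sum-cong-≗ λ d → u∼v (d ∷ a ∷ w) (λ ()) (s≤s |aw|≤K)) ⟨
  extended + isPrefix (a ∷ w) v                         ∎)
  where
  extended = sum (λ d → occ (d ∷ a ∷ w) u)

∼-suc⇒isSuffix-≡ : ∀ {m} {K} {u v y : Word m} → u ∼⟨ suc K ⟩ v → y ≢ [] → length y ≤ K →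
  isSuffix y u ≡ isSuffix y v
∼-suc⇒isSuffix-≡ {y = []} _ y≢[] _ = contradiction refl y≢[]
∼-suc⇒isSuffix-≡ {K = K} {u} {v} {y@(a ∷ w)} u∼v y≢[] |y|≤K = +-cancelˡ-≡ extended _ _ (begin
  extended + isSuffix y u                       ≡⟨ occ-right-extensions y u ⟨
  occ y u                                       ≡⟨ u∼v y y≢[] (m≤n⇒m≤1+n |y|≤K) ⟩
  occ y v                                       ≡⟨ occ-right-extensions y v ⟩
  sum (λ d → occ (y ∷ʳ d) v) + isSuffix y v     ≡⟨ cong (_+ isSuffix y v) (sum-cong-≗ λ d → u∼v (y ∷ʳ d) (λ ()) (|yd|≤1+K d)) ⟨
  extended + isSuffix y v                       ∎)
  where
  extended = sum (λ d → occ (y ∷ʳ d) u)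
  |yd|≤1+K : ∀ d → length (y ∷ʳ d) ≤ suc K
  |yd|≤1+K d = subst (_≤ suc K) (sym (length-∷ʳ y d)) (s≤s |y|≤K)

SameEnds : ∀ {m} → ℕ → Word m → Word m → Set
SameEnds K u v = SamePrefixes K u v × SamePrefixes K (reverse u) (reverse v)

SameEnds-mono : ∀ {m} {j K} {u v : Word m} → j ≤ K → SameEnds K u v → SameEnds j u v
SameEnds-mono j≤K (prefixes , suffixes) =
  (λ z |z|≤j → prefixes z (≤-trans |z|≤j j≤K)) , (λ z |z|≤j → suffixes z (≤-trans |z|≤j j≤K))

SameEnds⇒isSuffix-≡ : ∀ {m} {K} {u v y : Word m} → SameEnds K u v → y ≢ [] → length y ≤ K →
  isSuffix y u ≡ isSuffix y v
SameEnds⇒isSuffix-≡ {u = u} {v} {y} (_ , suffixes) y≢[] |y|≤K = begin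
  isSuffix y u                     ≡⟨ isSuffix-reverse u y≢[] ⟩
  isPrefix (reverse y) (reverse u) ≡⟨ suffixes (reverse y) (subst (_≤ _) (sym (length-reverse y)) |y|≤K) ⟩
  isPrefix (reverse y) (reverse v) ≡⟨ isSuffix-reverse v y≢[] ⟨
  isSuffix y v                     ∎

∼-suc⇒SameEnds : ∀ {m} {K} {u v : Word m} → u ∼⟨ suc K ⟩ v → SameEnds K u v
∼-suc⇒SameEnds {u = u} {v} u∼v = ∼-suc⇒SamePrefixes u∼v , suffixes
  where
  suffixes : SamePrefixes _ (reverse u) (reverse v)
  suffixes [] _ = refl
  suffixes z@(_ ∷ _) |z|≤K = begin
    isPrefix z (reverse u)           ≡⟨ cong (λ t → isPrefix t (reverse u)) (reverse-involutive z) ⟨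
    isPrefix (reverse y) (reverse u) ≡⟨ isSuffix-reverse u y≢[] ⟨
    isSuffix y u                     ≡⟨ ∼-suc⇒isSuffix-≡ {u = u} {v} u∼v y≢[] (subst (_≤ _) (sym (length-reverse z)) |z|≤K) ⟩
    isSuffix y v                     ≡⟨ isSuffix-reverse v y≢[] ⟩
    isPrefix (reverse y) (reverse v) ≡⟨ cong (λ t → isPrefix t (reverse v)) (reverse-involutive z) ⟩
    isPrefix z (reverse v)           ∎
    where
    y = reverse z
    y≢[] : y ≢ []
    y≢[] y≡[] with () ← trans (sym (reverse-involutive z)) (cong reverse y≡[])

slice-suc : ∀ {m} (ω : InfWord m) p n → slice ω p (suc n) ≡ ω p ∷ slice ω (suc p) n
slice-suc ω p n = cong₂ _∷_ (cong ω (+-identityʳ p)) (tabulate-cong λ j → cong ω (+-suc p _))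

isPrefix≢0⇒slice : ∀ {m} (ω : InfWord m) p (x s : Word m) → slice ω p (length s) ≡ s →
  isPrefix x s ≢ 0 → slice ω p (length x) ≡ x
isPrefix≢0⇒slice ω p [] s _ _ = refl
isPrefix≢0⇒slice ω p (a ∷ x) [] _ x≺s = contradiction refl x≺s
isPrefix≢0⇒slice ω p (a ∷ x) (b ∷ s) ω≡bs x≺s with a ≟ b
... | no _ = contradiction refl x≺s
... | yes refl with ω≡a , ω≡s ← ∷-injective (trans (sym (slice-suc ω p (length s))) ω≡bs) =
  trans (slice-suc ω p (length x)) (cong₂ _∷_ ω≡a (isPrefix≢0⇒slice ω (suc p) x s ω≡s x≺s))

occ≢0⇒Factor : ∀ {m} (ω : InfWord m) {x u : Word m} → Factor ω u → occ x u ≢ 0 → Factor ω x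
occ≢0⇒Factor ω {u = []} _ x∈u = contradiction refl x∈u
occ≢0⇒Factor ω {x} {c ∷ u} (p , ω≡cu) x∈cu with isPrefix x (c ∷ u) ≟ℕ 0
... | no x≺cu = p , isPrefix≢0⇒slice ω p x (c ∷ u) ω≡cu x≺cu
... | yes x⊀cu = occ≢0⇒Factor ω (suc p , ∷-injectiveʳ (trans (sym (slice-suc ω p (length u))) ω≡cu))
                   λ x∉u → x∈cu (cong₂ _+_ x⊀cu x∉u)

LeftSpecial : ∀ {m} → InfWord m → Word m → Set
LeftSpecial ω t = ∃ λ c → ∃ λ d → c ≢ d × Factor ω (c ∷ t) × Factor ω (d ∷ t)

module _ {m} (ω : InfWord m) (episturmian : Episturmian ω) where

  LeftSpecial⇒RightSpecial-reverse : ∀ {t} → LeftSpecial ω t → RightSpecial ω (reverse t)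
  LeftSpecial⇒RightSpecial-reverse {t} (c , d , c≢d , ct , dt) =
    c , d , c≢d , reversed c ct , reversed d dt
    where
    reversed : ∀ e → Factor ω (e ∷ t) → Factor ω (reverse t ∷ʳ e)
    reversed e et = subst (Factor ω) (unfold-reverse e t) (proj₁ episturmian (e ∷ t) et)

  LeftSpecial-unique : ∀ {s t} → length s ≡ length t → LeftSpecial ω s → LeftSpecial ω t → s ≡ t
  LeftSpecial-unique {s} {t} |s|≡|t| s-special t-special = reverse-injective
    (proj₂ episturmian (reverse s) (reverse t)
      (trans (length-reverse s) (trans |s|≡|t| (sym (length-reverse t))))
      (LeftSpecial⇒RightSpecial-reverse s-special) (LeftSpecial⇒RightSpecial-reverse t-special))

module Extension {m} (ω : InfWord m) (episturmian : Episturmian ω) {u v : Word m}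
  (u-factor : Factor ω u) (v-factor : Factor ω v)
  {j} (u∼v : u ∼⟨ suc j ⟩ v) (ends : SameEnds (suc j) u v) where

  Balanced : Word m → Set
  Balanced x = occ x u ≡ occ x v

  Absent : Word m → Set
  Absent x = occ x u ≡ 0 × occ x v ≡ 0

  absent? : ∀ x → Dec (Absent x)
  absent? x = (occ x u ≟ℕ 0) ×-dec (occ x v ≟ℕ 0)

  Absent⇒Balanced : ∀ {x} → Absent x → Balanced x
  Absent⇒Balanced (x∉u , x∉v) = trans x∉u (sym x∉v)

  present⇒Factor : ∀ x → ¬ Absent x → Factor ω x
  present⇒Factor x present with occ x u ≟ℕ 0 | occ x v ≟ℕ 0
  ... | no x∈u | _ = occ≢0⇒Factor ω u-factor x∈u
  ... | yes _ | no x∈v = occ≢0⇒Factor ω v-factor x∈v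
  ... | yes x∉u | yes x∉v = contradiction (x∉u , x∉v) present

  left-balanced : ∀ t → length t ≡ suc j → sum (λ d → occ (d ∷ t) u) ≡ sum (λ d → occ (d ∷ t) v)
  left-balanced t@(a ∷ w) |t| = +-cancelʳ-≡ (isPrefix t u) _ _ (begin
    sum (λ d → occ (d ∷ t) u) + isPrefix t u   ≡⟨ occ-left-extensions a w u ⟨
    occ t u                                   ≡⟨ u∼v t (λ ()) (≤-reflexive |t|) ⟩
    occ t v                                   ≡⟨ occ-left-extensions a w v ⟩
    sum (λ d → occ (d ∷ t) v) + isPrefix t v   ≡⟨ cong (sum (λ d → occ (d ∷ t) v) +_) (proj₁ ends t (≤-reflexive |t|)) ⟨
    sum (λ d → occ (d ∷ t) v) + isPrefix t u   ∎)

  right-balanced : ∀ y → length y ≡ suc j → sum (λ d → occ (y ∷ʳ d) u) ≡ sum (λ d → occ (y ∷ʳ d) v)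
  right-balanced y@(_ ∷ _) |y| = +-cancelʳ-≡ (isSuffix y u) _ _ (begin
    sum (λ d → occ (y ∷ʳ d) u) + isSuffix y u  ≡⟨ occ-right-extensions y u ⟨
    occ y u                                   ≡⟨ u∼v y (λ ()) (≤-reflexive |y|) ⟩
    occ y v                                   ≡⟨ occ-right-extensions y v ⟩
    sum (λ d → occ (y ∷ʳ d) v) + isSuffix y v  ≡⟨ cong (sum (λ d → occ (y ∷ʳ d) v) +_) (SameEnds⇒isSuffix-≡ ends (λ ()) (≤-reflexive |y|)) ⟨
    sum (λ d → occ (y ∷ʳ d) v) + isSuffix y u  ∎)

  Balanced-or-LeftSpecial : ∀ a t → length t ≡ suc j → Balanced (a ∷ t) ⊎ LeftSpecial ω t
  Balanced-or-LeftSpecial a t |t| with all? (λ e → ¬? (e ≟ a) →-dec absent? (e ∷ t))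
  ... | yes others-absent = inj₁ (sum-≡-at (λ e → occ (e ∷ t) u) (λ e → occ (e ∷ t) v) a
                              (left-balanced t |t|) λ e e≢a → Absent⇒Balanced (others-absent e e≢a))
  ... | no ¬others-absent with ¬∀⟶∃¬ m _ (λ e → ¬? (e ≟ a) →-dec absent? (e ∷ t)) ¬others-absent
  ...   | e , ¬[e≢a→absent] with absent? (a ∷ t)
  ...     | yes at-absent = inj₁ (Absent⇒Balanced at-absent)
  ...     | no at-present = inj₂ (a , e , a≢e , present⇒Factor (a ∷ t) at-present ,
                                  present⇒Factor (e ∷ t) (λ et-absent → ¬[e≢a→absent] λ _ → et-absent))
    where
    a≢e : a ≢ e
    a≢e a≡e = ¬[e≢a→absent] λ e≢a → contradiction (sym a≡e) e≢a

  Balanced-∷-∷ʳ : ∀ a w c → length w ≡ j → Balanced (a ∷ w ∷ʳ c)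
  Balanced-∷-∷ʳ a w c |w| = sum-≡⇒≗ (λ d → occ (a ∷ w ∷ʳ d) u) (λ d → occ (a ∷ w ∷ʳ d) v)
    (right-balanced (a ∷ w) (cong suc |w|)) at-most-one c
    where
    |wd| : ∀ d → length (w ∷ʳ d) ≡ suc j
    |wd| d = trans (length-∷ʳ w d) (cong suc |w|)
    at-most-one : ∀ d d′ → d ≢ d′ → Balanced (a ∷ w ∷ʳ d) ⊎ Balanced (a ∷ w ∷ʳ d′)
    at-most-one d d′ d≢d′ with Balanced-or-LeftSpecial a (w ∷ʳ d) (|wd| d)
                             | Balanced-or-LeftSpecial a (w ∷ʳ d′) (|wd| d′)
    ... | inj₁ balanced | _ = inj₁ balanced
    ... | inj₂ _ | inj₁ balanced = inj₂ balanced
    ... | inj₂ wd-special | inj₂ wd′-special = contradiction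
          (∷ʳ-injectiveʳ w w (LeftSpecial-unique ω episturmian (trans (|wd| d) (sym (|wd| d′))) wd-special wd′-special))
          d≢d′

  ∼-suc : u ∼⟨ suc (suc j) ⟩ v
  ∼-suc x x≢[] |x|≤2+j with length x ≤? suc j
  ... | yes |x|≤1+j = u∼v x x≢[] |x|≤1+j
  ... | no |x|≰1+j = longest x (≤-antisym |x|≤2+j (≰⇒> |x|≰1+j))
    where
    longest : ∀ x → length x ≡ suc (suc j) → Balanced x
    longest (a ∷ s) |as| with initLast s
    ... | w ∷ʳ′ c = Balanced-∷-∷ʳ a w c (suc-injective (trans (sym (length-∷ʳ w c)) (suc-injective |as|)))

SameEnds⇒pre-≡×suf-≡ : ∀ {m} {K} {u v : Word m} → SameEnds K u v →
  pre (length u ⊓ K) u ≡ pre (length u ⊓ K) v × suf (length u ⊓ K) u ≡ suf (length u ⊓ K) v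
SameEnds⇒pre-≡×suf-≡ {K = K} {u} (prefixes , suffixes) =
  SamePrefixes⇒take-≡ (m⊓n≤m (length u) K) (m⊓n≤n (length u) K) prefixes ,
  cong reverse (SamePrefixes⇒take-≡ (subst (length u ⊓ K ≤_) (sym (length-reverse u)) (m⊓n≤m (length u) K))
                                    (m⊓n≤n (length u) K) suffixes)

pre-≡×suf-≡⇒SameEnds : ∀ {m} {K} {u v : Word m} → length u ≡ length v →
  pre (length u ⊓ K) u ≡ pre (length u ⊓ K) v → suf (length u ⊓ K) u ≡ suf (length u ⊓ K) v →
  SameEnds K u v
pre-≡×suf-≡⇒SameEnds {K = K} {u} {v} |u|≡|v| pre≡ suf≡ =
  take-≡⇒SamePrefixes |u|≡|v| pre≡ ,
  take-≡⇒SamePrefixes (trans (length-reverse u) (trans |u|≡|v| (sym (length-reverse v))))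
    (subst (λ n → take (n ⊓ K) (reverse u) ≡ take (n ⊓ K) (reverse v)) (sym (length-reverse u))
      (reverse-injective suf≡))

∼₁×SameEnds⇒∼ : ∀ {m} (ω : InfWord m) → Episturmian ω → ∀ {u v} → Factor ω u → Factor ω v →
  u ∼⟨ 1 ⟩ v → ∀ K → SameEnds K u v → u ∼⟨ suc K ⟩ v
∼₁×SameEnds⇒∼ ω episturmian u-factor v-factor u∼v zero _ = u∼v
∼₁×SameEnds⇒∼ ω episturmian u-factor v-factor u∼v (suc K) ends =
  Extension.∼-suc ω episturmian u-factor v-factor
    (∼₁×SameEnds⇒∼ ω episturmian u-factor v-factor u∼v K (SameEnds-mono (n≤1+n K) ends)) ends

proposition8 : ∀ {m} (ω : InfWord m) → Episturmian ω → (k : ℕ) → 2 ≤ k →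
    ∀ (u v : Word m) → Factor ω u → Factor ω v →
      ((u ∼⟨ k ⟩ v) ⇔ ((u ∼⟨ k ∸ 1 ⟩ v) × pre (length u ⊓ (k ∸ 1)) u ≡ pre (length u ⊓ (k ∸ 1)) v × suf (length u ⊓ (k ∸ 1)) u ≡ suf (length u ⊓ (k ∸ 1)) v))
      × ((u ∼⟨ k ⟩ v) ⇔ ((u ∼⟨ 1 ⟩ v) × pre (length u ⊓ (k ∸ 1)) u ≡ pre (length u ⊓ (k ∸ 1)) v × suf (length u ⊓ (k ∸ 1)) u ≡ suf (length u ⊓ (k ∸ 1)) v))
proposition8 ω episturmian (suc (suc k)) (s≤s (s≤s z≤n)) u v u-factor v-factor =
  mk⇔ (λ u∼v → ∼-weaken {u = u} {v} (n≤1+n K) u∼v , ends u∼v)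
      (λ (u∼v , pre≡ , suf≡) → from (∼-weaken {u = u} {v} (s≤s z≤n) u∼v) pre≡ suf≡) ,
  mk⇔ (λ u∼v → ∼-weaken {u = u} {v} (s≤s z≤n) u∼v , ends u∼v)
      (λ (u∼v , pre≡ , suf≡) → from u∼v pre≡ suf≡)
  where
  K = suc k
  L = length u ⊓ K
  ends : u ∼⟨ suc K ⟩ v → pre L u ≡ pre L v × suf L u ≡ suf L v
  ends u∼v = SameEnds⇒pre-≡×suf-≡ (∼-suc⇒SameEnds {u = u} {v} u∼v)
  from : u ∼⟨ 1 ⟩ v → pre L u ≡ pre L v → suf L u ≡ suf L v → u ∼⟨ suc K ⟩ v
  from u∼v pre≡ suf≡ = ∼₁×SameEnds⇒∼ ω episturmian u-factor v-factor u∼v K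
    (pre-≡×suf-≡⇒SameEnds (∼₁⇒length-≡ {u = u} {v} u∼v) pre≡ suf≡)
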